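{- Let $\Sigma$ be a set of unary predicates. If $C=(S,\ll)$ is a certificate, then there exists a structure $\mathfrak{A}$ interpreting $\Sigma\cup\{\mathfrak{t}\}$, with $\mathfrak{t}^{\mathfrak{A}}$ transitive, over a domain of cardinality $2|S|$ such that, for every basic $\mathcal{FL}^21\mathrm{T}^u$-formula $\psi$ over $\Sigma\cup\{\mathfrak{t}\}$, $C\models\psi$ implies $\mathfrak{A}\models\psi$.
   Context: A 1-type over $\Sigma$ is a maximal consistent conjunction of literals $\pm p(x)$, $p\in\Sigma$; $\pi(y)$ is $\pi$ with $y$ substituted for $x$; $\mu$ ranges over quantifier-free $\Sigma$-formulas in the variable $x$. Basic formulas are those of the forms $\exists x.\mu$, $\forall x.\mu$, $\forall x(\pi\to\exists y(\mu(y)\wedge\pm\mathfrak{t}(x,y)))$, $\forall x(\pi\to\forall y(\pi'(y)\to\pm\mathfrak{t}(x,y)))$ with $\pi,\pi'$ 1-types. A super-type is a pair $\langle\pi,\Pi\rangle$ ($\pi$ a 1-type, $\Pi$ a set of 1-types); $\mathrm{tp}(S)=\{\pi:\langle\pi,\Pi\rangle\in S\}$. A certificate is a pair $(S,\ll)$ with $S$ a set of super-types and $\ll$ a transitive relation on $\mathrm{tp}(S)$ such that (C1) if $\langle\pi,\Pi\rangle\in S$ and $\pi'\in\Pi$, there is $\langle\pi',\Pi'\rangle\in S$ with $\Pi'\subseteq\Pi$; (C2) if $\pi\ll\pi'$, $\langle\pi,\Pi\rangle\in S$, $\langle\pi',\Pi'\rangle\in S$, then $\{\pi'\}\cup\Pi'\subseteq\Pi$.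 $C\models\psi$ means: (i) if $\psi=\forall x(\pi\to\exists y(\mu(y)\wedge\mathfrak{t}(x,y)))$, then for all $\Pi$ with $\langle\pi,\Pi\rangle\in S$ there is $\pi'\in\Pi$ with $\models\pi'\to\mu$; (ii) if $\psi=\forall x(\pi\to\forall y(\pi'(y)\to\mathfrak{t}(x,y)))$ and $\pi,\pi'\in\mathrm{tp}(S)$, then $\pi\ll\pi'$; (iii) if $\psi=\forall x(\pi\to\exists y(\mu(y)\wedge\neg\mathfrak{t}(x,y)))$, then for all $\langle\pi,\Pi\rangle\in S$ there is $\langle\pi',\Pi'\rangle\in S$ with $\models\pi'\to\mu$ and no $\alpha\in\{\pi\}\cup\Pi$ with $\alpha\ll\pi'$; (iv) if $\psi=\forall x(\pi\to\forall y(\pi'(y)\to\neg\mathfrak{t}(x,y)))$, then $\pi'\notin\Pi$ for all $\langle\pi,\Pi\rangle\in S$; (v) if $\psi=\exists x.\mu$, there is $\langle\pi,\Pi\rangle\in S$ with $\models\pi\to\mu$; (vi) if $\psi=\forall x.\mu$, then $\models\pi\to\mu$ for all $\langle\pi,\Pi\rangle\in S$. -}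

module Defs where

open import Data.Nat using (ℕ; _*_)
open import Data.Fin using (Fin)
open import Data.Bool using (Bool; true; false; not; _∧_; _∨_)
open import Data.Vec using (Vec; lookup)
open import Data.Product using (Σ; _×_; _,_; proj₁; proj₂; ∃)
open import Relation.Binary.PropositionalEquality using (_≡_)
open import Relation.Nullary using (¬_)

-- Signature Σ = {p₀, …, p_{n-1}} (unary predicates indexed by Fin n);
-- in addition there is the binary predicate 𝔱.

-- A 1-type over Σ: the maximal consistent conjunction of literals
-- ⋀ᵢ ±pᵢ(x), recorded by the sign of each pᵢ (true = positive literal).
OneType : ℕ → Set
OneType n = Vec Bool n

TypeSet : ℕ → Set
TypeSet n = OneType n → Bool

SuperType : ℕ → Set
SuperType n = OneType n × TypeSet n

-- Quantifier-free Σ-formulas in the single variable x.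
data QF (n : ℕ) : Set where
  atom : Fin n → QF n
  tt ff : QF n
  neg  : QF n → QF n
  conj disj : QF n → QF n → QF n

evalQF : ∀ {n} → (Fin n → Bool) → QF n → Bool
evalQF v (atom p) = v p
evalQF v tt = true
evalQF v ff = false
evalQF v (neg μ) = not (evalQF v μ)
evalQF v (conj μ ν) = evalQF v μ ∧ evalQF v ν
evalQF v (disj μ ν) = evalQF v μ ∨ evalQF v ν

SatType : ∀ {n} → (Fin n → Bool) → OneType n → Set
SatType v π = ∀ i → v i ≡ lookup π i

Valid⇒ : ∀ {n} → OneType n → QF n → Set
Valid⇒ {n} π μ = (v : Fin n → Bool) → SatType v π → evalQF v μ ≡ true

-- Basic formulas.  The Bool argument is the sign ± of 𝔱(x,y)
-- (true = 𝔱(x,y), false = ¬𝔱(x,y)).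
data Basic (n : ℕ) : Set where
  exists   : QF n → Basic n
  every   : QF n → Basic n
  all-ex   : OneType n → QF n → Bool → Basic n             -- ∀x(π → ∃y(μ(y) ∧ ±𝔱(x,y)))
  all-all  : OneType n → OneType n → Bool → Basic n        -- ∀x(π → ∀y(π'(y) → ±𝔱(x,y)))

-- Certificates.  S is given as an enumeration of its m = |S| pairwise
-- distinct super-types.
record Certificate (n : ℕ) : Set₁ where
  field
    size     : ℕ
    S        : Fin size → SuperType n
    distinct : ∀ i j → proj₁ (S i) ≡ proj₁ (S j)
               → (∀ α → proj₂ (S i) α ≡ proj₂ (S j) α) → i ≡ j
    _≪_      : OneType n → OneType n → Bool
  InTp : OneType n → Set
  InTp π = ∃ λ i → proj₁ (S i) ≡ π
  field
    ≪-on-tp  : ∀ π π' → π ≪ π' ≡ true → InTp π × InTp π'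
    ≪-trans  : ∀ π π' π'' → π ≪ π' ≡ true → π' ≪ π'' ≡ true → π ≪ π'' ≡ true
    C1 : ∀ i π' → proj₂ (S i) π' ≡ true →
         ∃ λ j → proj₁ (S j) ≡ π' × (∀ α → proj₂ (S j) α ≡ true → proj₂ (S i) α ≡ true)
    C2 : ∀ i j → proj₁ (S i) ≪ proj₁ (S j) ≡ true →
         proj₂ (S i) (proj₁ (S j)) ≡ true × (∀ α → proj₂ (S j) α ≡ true → proj₂ (S i) α ≡ true)

module _ {n : ℕ} (C : Certificate n) where
  open Certificate C

  CSat : Basic n → Set
  CSat (exists μ) = ∃ λ i → Valid⇒ (proj₁ (S i)) μ
  CSat (every μ) = ∀ i → Valid⇒ (proj₁ (S i)) μ
  CSat (all-ex π μ true) =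
    ∀ i → proj₁ (S i) ≡ π → Σ (OneType n) λ π' → proj₂ (S i) π' ≡ true × Valid⇒ π' μ
  CSat (all-ex π μ false) =
    ∀ i → proj₁ (S i) ≡ π → ∃ λ j → Valid⇒ (proj₁ (S j)) μ
      × ¬ (π ≪ proj₁ (S j) ≡ true)
      × (∀ α → proj₂ (S i) α ≡ true → ¬ (α ≪ proj₁ (S j) ≡ true))
  CSat (all-all π π' true) = InTp π → InTp π' → π ≪ π' ≡ true
  CSat (all-all π π' false) = ∀ i → proj₁ (S i) ≡ π → proj₂ (S i) π' ≡ false

record Structure (n d : ℕ) : Set where
  field
    pred : Fin d → Fin n → Bool
    tr   : Fin d → Fin d → Bool

TransitiveT : ∀ {n d} → Structure n d → Set
TransitiveT {d = d} 𝔄 = (a b c : Fin d) → tr a b ≡ true → tr b c ≡ true → tr a c ≡ true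
  where open Structure 𝔄

ASat : ∀ {n d} → Structure n d → Basic n → Set
ASat {d = d} 𝔄 (exists μ) = ∃ λ (a : Fin d) → evalQF (Structure.pred 𝔄 a) μ ≡ true
ASat {d = d} 𝔄 (every μ) = (a : Fin d) → evalQF (Structure.pred 𝔄 a) μ ≡ true
ASat {d = d} 𝔄 (all-ex π μ s) =
  (a : Fin d) → SatType (Structure.pred 𝔄 a) π →
    ∃ λ (b : Fin d) → evalQF (Structure.pred 𝔄 b) μ ≡ true × Structure.tr 𝔄 a b ≡ s
ASat {d = d} 𝔄 (all-all π π' s) =
  (a : Fin d) → SatType (Structure.pred 𝔄 a) π →
    (b : Fin d) → SatType (Structure.pred 𝔄 b) π' → Structure.tr 𝔄 a b ≡ s

-- Take two copies of every super-type ⟨π, Π⟩ of S, each realising π.  An element of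
-- ⟨π, Π⟩ gets a 𝔱-edge to an element of ⟨π', Π'⟩ if the edge is forced (π ≪ π', or
-- α ≪ π' for some α ∈ Π) and, into the first copy only, whenever it is allowed
-- (π' ∈ Π and Π' ⊆ Π).  By (C1) and (C2) forced edges are allowed, and allowed edges
-- followed by forced (resp. allowed) ones are forced (resp. allowed), so 𝔱 is
-- transitive.  Witnesses for ∃y(μ ∧ 𝔱) are found in the first copy via (C1), and
-- witnesses for ∃y(μ ∧ ¬𝔱) in the second copy, which only forced edges enter.
module Submission where

open import Defs
open import Data.Nat using (ℕ; _*_)
open import Data.Product using (Σ; _×_; _,_; proj₁; proj₂; ∃)
open import Data.Sum using (_⊎_; inj₁; inj₂)
open import Data.Fin as Fin using (Fin; zero; suc; combine; remQuot)
open import Data.Fin.Properties using (any?; all?; remQuot-combine; 0≢1+n)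
open import Data.Bool using (true; false)
open import Data.Bool.Properties using (_≟_)
open import Data.Vec using (Vec; lookup; tabulate)
open import Data.Vec.Properties using (tabulate∘lookup; tabulate-cong)
open import Data.Empty using (⊥-elim)
open import Function using (_∘′_; case_of_)
open import Relation.Nullary using (¬_; Dec; yes; does)
open import Relation.Nullary.Decidable using (_×-dec_; _⊎-dec_; _→-dec_; dec-true; dec-false)
open import Relation.Binary.PropositionalEquality

does-true⇒ : ∀ {a} {A : Set a} (A? : Dec A) → does A? ≡ true → A
does-true⇒ (yes a) _ = a

lookup-ext : ∀ {a n} {A : Set a} (xs ys : Vec A n) → lookup xs ≗ lookup ys → xs ≡ ys
lookup-ext xs ys xs≗ys = begin
  xs                   ≡⟨ tabulate∘lookup xs ⟨
  tabulate (lookup xs) ≡⟨ tabulate-cong xs≗ys ⟩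
  tabulate (lookup ys) ≡⟨ tabulate∘lookup ys ⟩
  ys                   ∎
  where open ≡-Reasoning

module Model {n : ℕ} (C : Certificate n) where
  open Certificate C

  tp : Fin size → OneType n
  tp i = proj₁ (S i)

  Π : Fin size → TypeSet n
  Π i = proj₂ (S i)

  -- Inclusion Π j ⊆ Π i is only required on tp(S), which is what makes it decidable.
  Allowed : Fin size → Fin size → Set
  Allowed i j = Π i (tp j) ≡ true × (∀ k → Π j (tp k) ≡ true → Π i (tp k) ≡ true)

  Forced : Fin size → Fin size → Set
  Forced i j = tp i ≪ tp j ≡ true ⊎ ∃ λ k → Π i (tp k) ≡ true × tp k ≪ tp j ≡ true

  allowed? : ∀ i j → Dec (Allowed i j)
  allowed? i j =
    (Π i (tp j) ≟ true) ×-dec all? (λ k → (Π j (tp k) ≟ true) →-dec (Π i (tp k) ≟ true))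

  forced? : ∀ i j → Dec (Forced i j)
  forced? i j =
    (tp i ≪ tp j ≟ true) ⊎-dec any? (λ k → (Π i (tp k) ≟ true) ×-dec (tp k ≪ tp j ≟ true))

  Allowed-trans : ∀ {i j k} → Allowed i j → Allowed j k → Allowed i k
  Allowed-trans (_ , Πj⊆Πi) (πk∈Πj , Πk⊆Πj) = Πj⊆Πi _ πk∈Πj , λ l → Πj⊆Πi l ∘′ Πk⊆Πj l

  ≪⇒Allowed : ∀ {i j} → tp i ≪ tp j ≡ true → Allowed i j
  ≪⇒Allowed {i} {j} i≪j = proj₁ (C2 i j i≪j) , λ k → proj₂ (C2 i j i≪j) (tp k)

  Allowed-⊆ : ∀ {i j k} → (∀ α → Π j α ≡ true → Π i α ≡ true) → Allowed j k → Allowed i k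
  Allowed-⊆ Πj⊆Πi (πk∈Πj , Πk⊆Πj) = Πj⊆Πi _ πk∈Πj , λ l → Πj⊆Πi (tp l) ∘′ Πk⊆Πj l

  Forced⇒Allowed : ∀ {i j} → Forced i j → Allowed i j
  Forced⇒Allowed (inj₁ i≪j) = ≪⇒Allowed i≪j
  Forced⇒Allowed {i} {j} (inj₂ (k , πk∈Πi , k≪j)) with C1 i (tp k) πk∈Πi
  ... | l , πl≡πk , Πl⊆Πi =
    Allowed-⊆ Πl⊆Πi (≪⇒Allowed (subst (λ π → π ≪ tp j ≡ true) (sym πl≡πk) k≪j))

  Allowed-Forced⇒Forced : ∀ {i j k} → Allowed i j → Forced j k → Forced i k
  Allowed-Forced⇒Forced {j = j} (πj∈Πi , _) (inj₁ j≪k) = inj₂ (j , πj∈Πi , j≪k)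
  Allowed-Forced⇒Forced (_ , Πj⊆Πi) (inj₂ (l , πl∈Πj , l≪k)) = inj₂ (l , Πj⊆Πi l πl∈Πj , l≪k)

  Dom : Set
  Dom = Fin (2 * size)

  point : Fin 2 → Fin size → Dom
  point = combine

  copy : Dom → Fin 2
  copy a = proj₁ (remQuot {2} size a)

  sort : Dom → Fin size
  sort a = proj₂ (remQuot {2} size a)

  copy-point : ∀ c i → copy (point c i) ≡ c
  copy-point c i = cong proj₁ (remQuot-combine {2} {size} c i)

  sort-point : ∀ c i → sort (point c i) ≡ i
  sort-point c i = cong proj₂ (remQuot-combine {2} {size} c i)

  Edge : Dom → Dom → Set
  Edge a b = Forced (sort a) (sort b) ⊎ (copy b ≡ zero × Allowed (sort a) (sort b))

  edge? : ∀ a b → Dec (Edge a b)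
  edge? a b = forced? (sort a) (sort b) ⊎-dec ((copy b Fin.≟ zero) ×-dec allowed? (sort a) (sort b))

  Edge⇒Allowed : ∀ {a b} → Edge a b → Allowed (sort a) (sort b)
  Edge⇒Allowed (inj₁ forced) = Forced⇒Allowed forced
  Edge⇒Allowed (inj₂ (_ , allowed)) = allowed

  Edge-trans : ∀ {a b c} → Edge a b → Edge b c → Edge a c
  Edge-trans ab (inj₁ forced) = inj₁ (Allowed-Forced⇒Forced (Edge⇒Allowed ab) forced)
  Edge-trans ab (inj₂ (c₀ , allowed)) = inj₂ (c₀ , Allowed-trans (Edge⇒Allowed ab) allowed)

  𝔄 : Structure n (2 * size)
  𝔄 = record { pred = λ a → lookup (tp (sort a)) ; tr = λ a b → does (edge? a b) }

  𝔄-transitive : TransitiveT 𝔄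
  𝔄-transitive a b c ab bc =
    dec-true (edge? a c) (Edge-trans (does-true⇒ (edge? a b) ab) (does-true⇒ (edge? b c) bc))

  sort-type : ∀ {a π} → SatType (Structure.pred 𝔄 a) π → tp (sort a) ≡ π
  sort-type = lookup-ext _ _

  point-valid : ∀ c i μ → Valid⇒ (tp i) μ → evalQF (Structure.pred 𝔄 (point c i)) μ ≡ true
  point-valid c i μ valid rewrite sort-point c i = valid _ λ _ → refl

  edge-into-first : ∀ a i → Allowed (sort a) i → Edge a (point zero i)
  edge-into-first a i allowed =
    inj₂ (copy-point zero i , subst (Allowed (sort a)) (sym (sort-point zero i)) allowed)

  edge-into-second : ∀ a i → Edge a (point (suc zero) i) → Forced (sort a) i
  edge-into-second a i (inj₁ forced) = subst (Forced (sort a)) (sort-point (suc zero) i) forced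
  edge-into-second a i (inj₂ (c≡0 , _)) = ⊥-elim (0≢1+n (trans (sym c≡0) (copy-point (suc zero) i)))

  sound : (ψ : Basic n) → CSat C ψ → ASat 𝔄 ψ
  sound (exists μ) (i , valid) = point zero i , point-valid zero i μ valid
  sound (every μ) valid a = valid (sort a) _ λ _ → refl
  sound (all-ex π μ true) witness a s with witness (sort a) (sort-type s)
  ... | π' , π'∈Π , valid with C1 (sort a) π' π'∈Π
  ... | j , πj≡π' , Πj⊆Π =
      point zero j
    , point-valid zero j μ (subst (λ π → Valid⇒ π μ) (sym πj≡π') valid)
    , dec-true (edge? a (point zero j))
        (edge-into-first a j (subst (λ π → Π (sort a) π ≡ true) (sym πj≡π') π'∈Π , λ k → Πj⊆Π (tp k)))
  sound (all-ex π μ false) witness a s with witness (sort a) (sort-type s)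
  ... | j , valid , π≪̸πj , Π≪̸πj =
      point (suc zero) j
    , point-valid (suc zero) j μ valid
    , dec-false (edge? a (point (suc zero) j)) (not-forced ∘′ edge-into-second a j)
    where
    not-forced : ¬ Forced (sort a) j
    not-forced (inj₁ a≪j) = π≪̸πj (subst (λ π → π ≪ tp j ≡ true) (sort-type s) a≪j)
    not-forced (inj₂ (k , πk∈Π , k≪j)) = Π≪̸πj (tp k) πk∈Π k≪j
  sound (all-all π π' true) π≪π' a s b s' =
    dec-true (edge? a b) (inj₁ (inj₁ (subst₂ (λ α β → α ≪ β ≡ true)
      (sym (sort-type s)) (sym (sort-type s')) (π≪π' (sort a , sort-type s) (sort b , sort-type s')))))
  sound (all-all π π' false) π'∉Π a s b s' = dec-false (edge? a b) λ ab →
    let π'∈Π = subst (λ β → Π (sort a) β ≡ true) (sort-type s') (proj₁ (Edge⇒Allowed ab))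
    in case trans (sym π'∈Π) (π'∉Π (sort a) (sort-type s)) of λ ()

lemma4 : {n : ℕ} (C : Certificate n) →
    Σ (Structure n (2 * Certificate.size C)) λ 𝔄 →
    TransitiveT 𝔄 × ((ψ : Basic n) → CSat C ψ → ASat 𝔄 ψ)
lemma4 C = 𝔄 , 𝔄-transitive , sound
  where open Model C
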